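{- Let $S_O\subseteq\mathbb S_O$ be a finite knowledge base, $A=\mathrm{Atom}(S_O)$, and let $\tilde S_O=(S_O\setminus S_O^-)\cup S_O^+$ where $S_O^-\subseteq S_O$ and $S_O^+\subseteq\mathbb S_O\setminus S_O$ (with $\tilde S_O$ finite). Then: (i) $\rho_{\mathrm{Atom}}(S_O,\tilde S_O)=1$ if and only if $A\cap S_O^-=\varnothing$; (ii) if $A\cap S_O^-=\varnothing$, then $\mathrm{Cn}(S_O)\subseteq\mathrm{Cn}(\tilde S_O)$; (iii) if $A\cap S_O^-=\varnothing$ and $S_O^+\subseteq\mathrm{Cn}(S_O)$, then $\mathrm{Cn}(S_O)=\mathrm{Cn}(\tilde S_O)$ and $\mathsf F_{\mathrm{Cn}}(S_O,\tilde S_O)=1$; (iv) if $S_O^-=S_O^+=\varnothing$, then $\rho_{\mathrm{Atom}}=1$ and $\mathsf F_{\mathrm{Cn}}=1$.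
   Context: $\mathbb S_O$ is a countable semantic universe with deductive closure $\mathrm{Cn}$ from a fixed proof system satisfying reflexivity, monotonicity and idempotence; closures of finite sets are finite and membership is decidable. Knowledge bases are finite, listed in a canonical order; $\mathrm{Atom}(S)$ is obtained by scanning $S$ in canonical order from $A=S$ and deleting $s$ whenever $s\in\mathrm{Cn}(A\setminus\{s\})$ (so $\mathrm{Cn}(\mathrm{Atom}(S))=\mathrm{Cn}(S)$). $\rho_{\mathrm{Atom}}(S_O,\hat S)=|A\cap\hat S|/|A|$ ($0/0:=1$). $\mathsf F_{\mathrm{Cn}}(S,\hat S)=|\mathrm{Cn}(S)\cap\mathrm{Cn}(\hat S)|/|\mathrm{Cn}(S)\cup\mathrm{Cn}(\hat S)|$ ($0/0:=1$). -}

module Defs where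

open import Data.Nat using (ℕ; zero; suc; _<_)
open import Data.Integer using (+_)
open import Data.Rational using (ℚ; _/_; 1ℚ)
open import Data.List using (List; []; _∷_; _++_; filter; length; deduplicate)
open import Data.List.Membership.Propositional using (_∈_; _∉_)
open import Data.List.Relation.Unary.AllPairs using (AllPairs)
open import Data.Product using (_×_)
open import Data.Sum using (_⊎_)
open import Function.Definitions using (Injective)
open import Relation.Binary.PropositionalEquality using (_≡_)
open import Relation.Binary.Definitions using (DecidableEquality)
open import Relation.Nullary using (¬?; yes; no)
import Data.List.Membership.DecPropositional as DecMem

-- Finite sets over a universe are represented by lists; subset is by membership.
_⊆ₗ_ : {U : Set} → List U → List U → Set
S ⊆ₗ T = ∀ {x} → x ∈ S → x ∈ T

-- The semantic universe 𝕊_O together with the deductive closure Cn of a fixed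
-- proof system, restricted to finite sets (closures of finite sets are finite).
record ProofSystem : Set₁ where
  field
    U        : Set
    _≟_      : DecidableEquality U
    -- countability: an injective coding into ℕ (also fixes the canonical order)
    code     : U → ℕ
    code-inj : Injective _≡_ _≡_ code
    Cn       : List U → List U
    Cn-refl  : ∀ S → S ⊆ₗ Cn S
    Cn-mono  : ∀ S T → S ⊆ₗ T → Cn S ⊆ₗ Cn T
    Cn-idem  : ∀ S → Cn (Cn S) ⊆ₗ Cn S

module _ (P : ProofSystem) where
  open ProofSystem P
  open DecMem _≟_ using (_∈?_)

  Canonical : List U → Set
  Canonical S = AllPairs (λ x y → code x < code y) S

  remove : U → List U → List U
  remove s A = filter (λ x → ¬? (x ≟ s)) A

  atomScan : List U → List U → List U
  atomScan A [] = A
  atomScan A (s ∷ rest) with s ∈? Cn (remove s A)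
  ... | yes _ = atomScan (remove s A) rest
  ... | no  _ = atomScan A rest

  Atom : List U → List U
  Atom S = atomScan S S

  _∩ₗ_ : List U → List U → List U
  X ∩ₗ Y = deduplicate _≟_ (filter (_∈? Y) X)

  _∪ₗ_ : List U → List U → List U
  X ∪ₗ Y = deduplicate _≟_ (X ++ Y)

  -- n / d with the convention 0/0 := 1
  ratio : ℕ → ℕ → ℚ
  ratio n zero    = 1ℚ
  ratio n (suc d) = (+ n) / suc d

  ρAtom : List U → List U → ℚ
  ρAtom S Ŝ = ratio (length (Atom S ∩ₗ Ŝ)) (length (deduplicate _≟_ (Atom S)))

  FCn : List U → List U → ℚ
  FCn S Ŝ = ratio (length (Cn S ∩ₗ Cn Ŝ)) (length (Cn S ∪ₗ Cn Ŝ))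

-- Atom(S) is a subset of S with the same closure, since the scan only deletes
-- sentences already derivable from what remains. Elements of the revision S̃ that
-- come from S are exactly those not in S⁻ (S⁺ is disjoint from S), so
-- Atom(S) ⊆ S̃ iff Atom(S) avoids S⁻; this gives (i), since ρ_Atom = 1 says precisely
-- Atom(S) ⊆ S̃. Then Cn(S) ⊆ Cn(Atom S) ⊆ Cn(S̃) gives (ii). If moreover S⁺ ⊆ Cn(S),
-- then S̃ ⊆ Cn(S) and idempotence gives the reverse inclusion of (iii); equal
-- closures give F_Cn = 1. Part (iv) is the special case S⁻ = S⁺ = ∅ of (i) and (iii).
-- Ratios are compared through sizes of duplicate-free lists: a duplicate-free list
-- contained in another is no longer, and strictly shorter if it misses an element.
module Submission where

open import Defs
open import Data.List using (List; []; _∷_; _++_; filter; length; deduplicate)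
open import Data.List.Membership.Propositional using (_∈_; _∉_)
open import Data.Product using (_×_; _,_; proj₁; proj₂)
open import Data.Sum using (_⊎_; inj₁; inj₂)
open import Data.Rational using (1ℚ)
open import Relation.Binary.PropositionalEquality using (_≡_; refl; sym; trans; _≢_)
open import Function.Bundles using (_⇔_; mk⇔; Equivalence)

open import Data.Nat using (zero; suc; _≤_; _<_; z≤n; s≤s; NonZero)
open import Data.Nat.Properties using (≤-<-trans; ≤-antisym; <-irrefl; *-identityˡ; *-identityʳ)
open import Data.Integer using (+_)
import Data.Integer.Properties as ℤ
open import Data.Rational using (_/_)
open import Data.Rational.Properties using (fromℚᵘ-cong; normalize-injective-≃)
open import Data.Rational.Unnormalised using (mkℚᵘ; *≡*)
open import Relation.Binary.Definitions using (DecidableEquality)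
open import Relation.Nullary using (¬?; yes; no; contradiction)
open import Data.List.Properties using (filter-notAll)
open import Data.List.Relation.Unary.Any as Any using (here; there)
open import Data.List.Relation.Unary.Any.Properties using (¬Any[])
open import Data.List.Relation.Unary.All as All using ()
open import Data.List.Relation.Unary.AllPairs using (_∷_)
open import Data.List.Relation.Unary.Unique.Propositional using (Unique)
open import Data.List.Relation.Unary.Unique.DecPropositional.Properties using (deduplicate-!)
open import Data.List.Membership.Propositional.Properties
  using (∈-filter⁺; ∈-filter⁻; ∈-deduplicate⁺; ∈-deduplicate⁻; ∈-++⁺ˡ; ∈-++⁻)
import Data.List.Membership.DecPropositional as DecMembership
import Function.Properties.Equivalence as ⇔

n/n≡1 : ∀ n .{{_ : NonZero n}} → + n / n ≡ 1ℚ
n/n≡1 n@(suc k) = fromℚᵘ-cong {mkℚᵘ (+ n) k} {mkℚᵘ (+ 1) 0}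
  (*≡* (trans (ℤ.*-identityʳ (+ n)) (sym (ℤ.*-identityˡ (+ n)))))

m/n≡1⇒m≡n : ∀ m n .{{_ : NonZero n}} → + m / n ≡ 1ℚ → m ≡ n
m/n≡1⇒m≡n m n@(suc _) eq = trans (sym (*-identityʳ m)) (trans (normalize-injective-≃ m 1 n 1 eq) (*-identityˡ n))

module _ {A : Set} (_≟_ : DecidableEquality A) where

  private
    without : A → List A → List A
    without x = filter (λ y → ¬? (y ≟ x))

    length-without-< : ∀ {x ys} → x ∈ ys → length (without x ys) < length ys
    length-without-< {x} {ys} x∈ys =
      filter-notAll (λ y → ¬? (y ≟ x)) ys (Any.map (λ x≡y y≢x → y≢x (sym x≡y)) x∈ys)

    ⊆-without : ∀ {x xs ys} → xs ⊆ₗ ys → x ∉ xs → xs ⊆ₗ without x ys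
    ⊆-without {x} xs⊆ys x∉xs z∈xs =
      ∈-filter⁺ (λ y → ¬? (y ≟ x)) (xs⊆ys z∈xs) (λ { refl → x∉xs z∈xs })

  Unique-length-≤ : ∀ {xs ys : List A} → Unique xs → xs ⊆ₗ ys → length xs ≤ length ys
  Unique-length-< : ∀ {xs ys : List A} {y} →
                    Unique xs → xs ⊆ₗ ys → y ∈ ys → y ∉ xs → length xs < length ys

  Unique-length-≤ {[]}     _            _         = z≤n
  Unique-length-≤ {x ∷ xs} (x≢xs ∷ !xs) x∷xs⊆ys =
    Unique-length-< !xs (λ p → x∷xs⊆ys (there p)) (x∷xs⊆ys (here refl)) (λ p → All.lookup x≢xs p refl)

  Unique-length-< !xs xs⊆ys y∈ys y∉xs =
    ≤-<-trans (Unique-length-≤ !xs (⊆-without xs⊆ys y∉xs)) (length-without-< y∈ys)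

  length-deduplicate-≡ : ∀ {xs ys : List A} → xs ⊆ₗ ys → ys ⊆ₗ xs →
                         length (deduplicate _≟_ xs) ≡ length (deduplicate _≟_ ys)
  length-deduplicate-≡ {xs} {ys} xs⊆ys ys⊆xs = ≤-antisym
    (Unique-length-≤ (deduplicate-! _≟_ xs) (λ p → ∈-deduplicate⁺ _≟_ (xs⊆ys (∈-deduplicate⁻ _≟_ xs p))))
    (Unique-length-≤ (deduplicate-! _≟_ ys) (λ p → ∈-deduplicate⁺ _≟_ (ys⊆xs (∈-deduplicate⁻ _≟_ ys p))))

  length-deduplicate-< : ∀ {xs ys : List A} {y} → xs ⊆ₗ ys → y ∈ ys → y ∉ xs →
                         length (deduplicate _≟_ xs) < length (deduplicate _≟_ ys)
  length-deduplicate-< {xs} {ys} xs⊆ys y∈ys y∉xs = Unique-length-< (deduplicate-! _≟_ xs)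
    (λ p → ∈-deduplicate⁺ _≟_ (xs⊆ys (∈-deduplicate⁻ _≟_ xs p)))
    (∈-deduplicate⁺ _≟_ y∈ys)
    (λ p → y∉xs (∈-deduplicate⁻ _≟_ xs p))

module _ (P : ProofSystem) where
  open ProofSystem P
  open DecMembership _≟_ using (_∈?_)

  ratio-≡⇒≡1 : ∀ {m n} → m ≡ n → ratio P m n ≡ 1ℚ
  ratio-≡⇒≡1 {n = zero}  _    = refl
  ratio-≡⇒≡1 {n = suc k} refl = n/n≡1 (suc k)

  ratio-<⇒≢1 : ∀ {m n} → m < n → ratio P m n ≢ 1ℚ
  ratio-<⇒≢1 {m} {suc _} m<n eq = <-irrefl (m/n≡1⇒m≡n m _ eq) m<n

  ρAtom≡1⇔Atom⊆ : ∀ S T → ρAtom P S T ≡ 1ℚ ⇔ Atom P S ⊆ₗ T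
  ρAtom≡1⇔Atom⊆ S T = mk⇔ to from
    where
    A = Atom P S

    A∩T⊆A : filter (_∈? T) A ⊆ₗ A
    A∩T⊆A p = proj₁ (∈-filter⁻ (_∈? T) {xs = A} p)

    to : ρAtom P S T ≡ 1ℚ → A ⊆ₗ T
    to ρ≡1 {x} x∈A with x ∈? T
    ... | yes x∈T = x∈T
    ... | no  x∉T = contradiction ρ≡1 (ratio-<⇒≢1 (length-deduplicate-< _≟_ A∩T⊆A x∈A
                      (λ p → x∉T (proj₂ (∈-filter⁻ (_∈? T) {xs = A} p)))))

    from : A ⊆ₗ T → ρAtom P S T ≡ 1ℚ
    from A⊆T = ratio-≡⇒≡1 (length-deduplicate-≡ _≟_ A∩T⊆A (λ p → ∈-filter⁺ (_∈? T) p (A⊆T p)))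

  FCn-≡1 : ∀ S T → Cn S ⊆ₗ Cn T → Cn T ⊆ₗ Cn S → FCn P S T ≡ 1ℚ
  FCn-≡1 S T CnS⊆CnT CnT⊆CnS = ratio-≡⇒≡1 (length-deduplicate-≡ _≟_ ∩⊆∪ ∪⊆∩)
    where
    ∩⊆∪ : filter (_∈? Cn T) (Cn S) ⊆ₗ (Cn S ++ Cn T)
    ∩⊆∪ p = ∈-++⁺ˡ (proj₁ (∈-filter⁻ (_∈? Cn T) {xs = Cn S} p))

    ∪⊆∩ : (Cn S ++ Cn T) ⊆ₗ filter (_∈? Cn T) (Cn S)
    ∪⊆∩ p with ∈-++⁻ (Cn S) p
    ... | inj₁ q = ∈-filter⁺ (_∈? Cn T) q (CnS⊆CnT q)
    ... | inj₂ q = ∈-filter⁺ (_∈? Cn T) (CnT⊆CnS q) q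

  Cn-least : ∀ S T → S ⊆ₗ Cn T → Cn S ⊆ₗ Cn T
  Cn-least S T S⊆CnT p = Cn-idem T (Cn-mono S (Cn T) S⊆CnT p)

  Cn-⊆-Cn-remove : ∀ s A → s ∈ Cn (remove P s A) → Cn A ⊆ₗ Cn (remove P s A)
  Cn-⊆-Cn-remove s A s∈Cn = Cn-least A (remove P s A) A⊆Cn
    where
    A⊆Cn : A ⊆ₗ Cn (remove P s A)
    A⊆Cn {x} x∈A with x ≟ s
    ... | yes refl = s∈Cn
    ... | no  x≢s  = Cn-refl (remove P s A) (∈-filter⁺ (λ y → ¬? (y ≟ s)) x∈A x≢s)

  atomScan-⊆ : ∀ A rest → atomScan P A rest ⊆ₗ A
  atomScan-⊆ A []         p = p
  atomScan-⊆ A (s ∷ rest) p with s ∈? Cn (remove P s A)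
  ... | yes _ = proj₁ (∈-filter⁻ (λ y → ¬? (y ≟ s)) (atomScan-⊆ (remove P s A) rest p))
  ... | no  _ = atomScan-⊆ A rest p

  Cn-⊆-Cn-atomScan : ∀ A rest → Cn A ⊆ₗ Cn (atomScan P A rest)
  Cn-⊆-Cn-atomScan A []         p = p
  Cn-⊆-Cn-atomScan A (s ∷ rest) p with s ∈? Cn (remove P s A)
  ... | yes s∈Cn = Cn-⊆-Cn-atomScan (remove P s A) rest (Cn-⊆-Cn-remove s A s∈Cn p)
  ... | no  _    = Cn-⊆-Cn-atomScan A rest p

  IsRevision : (S S⁻ S⁺ S̃ : List U) → Set
  IsRevision S S⁻ S⁺ S̃ = ∀ x → x ∈ S̃ ⇔ ((x ∈ S × x ∉ S⁻) ⊎ x ∈ S⁺)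

  ⊆-revision⇔disjoint : ∀ {S S⁻ S⁺ S̃ X} → IsRevision S S⁻ S⁺ S̃ →
    (∀ {x} → x ∈ S⁺ → x ∉ S) → X ⊆ₗ S → X ⊆ₗ S̃ ⇔ (∀ {x} → x ∈ X → x ∉ S⁻)
  ⊆-revision⇔disjoint {S⁻ = S⁻} {S̃ = S̃} {X} rev fresh X⊆S = mk⇔ to from
    where
    to : X ⊆ₗ S̃ → ∀ {x} → x ∈ X → x ∉ S⁻
    to X⊆S̃ {x} x∈X with Equivalence.to (rev x) (X⊆S̃ x∈X)
    ... | inj₁ (_ , x∉S⁻) = x∉S⁻
    ... | inj₂ x∈S⁺       = contradiction (X⊆S x∈X) (fresh x∈S⁺)

    from : (∀ {x} → x ∈ X → x ∉ S⁻) → X ⊆ₗ S̃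
    from X∩S⁻≡∅ {x} x∈X = Equivalence.from (rev x) (inj₁ (X⊆S x∈X , X∩S⁻≡∅ x∈X))

  revision-⊆-Cn : ∀ {S S⁻ S⁺ S̃} → IsRevision S S⁻ S⁺ S̃ → S⁺ ⊆ₗ Cn S → S̃ ⊆ₗ Cn S
  revision-⊆-Cn {S} rev S⁺⊆CnS {x} x∈S̃ with Equivalence.to (rev x) x∈S̃
  ... | inj₁ (x∈S , _) = Cn-refl S x∈S
  ... | inj₂ x∈S⁺      = S⁺⊆CnS x∈S⁺

proposition5 : (P : ProofSystem) → let open ProofSystem P in
    (S S⁻ S⁺ S̃ : List U) →
    Canonical P S →
    S⁻ ⊆ₗ S →
    (∀ {x} → x ∈ S⁺ → x ∉ S) →
    (∀ x → x ∈ S̃ ⇔ ((x ∈ S × x ∉ S⁻) ⊎ x ∈ S⁺)) →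
    let A = Atom P S in
    ((ρAtom P S S̃ ≡ 1ℚ) ⇔ (∀ {x} → x ∈ A → x ∉ S⁻))
    × ((∀ {x} → x ∈ A → x ∉ S⁻) → Cn S ⊆ₗ Cn S̃)
    × ((∀ {x} → x ∈ A → x ∉ S⁻) → S⁺ ⊆ₗ Cn S →
        (Cn S ⊆ₗ Cn S̃ × Cn S̃ ⊆ₗ Cn S) × FCn P S S̃ ≡ 1ℚ)
    × (S⁻ ≡ [] → S⁺ ≡ [] → ρAtom P S S̃ ≡ 1ℚ × FCn P S S̃ ≡ 1ℚ)
proposition5 P S S⁻ S⁺ S̃ _ _ fresh rev = ρ≡1⇔A∩S⁻≡∅ , Cn-S⊆Cn-S̃ , Cn-S≡Cn-S̃ , unchanged
  where
  open ProofSystem P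
  A = Atom P S

  A⊆S̃⇔A∩S⁻≡∅ : A ⊆ₗ S̃ ⇔ (∀ {x} → x ∈ A → x ∉ S⁻)
  A⊆S̃⇔A∩S⁻≡∅ = ⊆-revision⇔disjoint P rev fresh (atomScan-⊆ P S S)

  ρ≡1⇔A∩S⁻≡∅ : ρAtom P S S̃ ≡ 1ℚ ⇔ (∀ {x} → x ∈ A → x ∉ S⁻)
  ρ≡1⇔A∩S⁻≡∅ = ⇔.trans (ρAtom≡1⇔Atom⊆ P S S̃) A⊆S̃⇔A∩S⁻≡∅

  Cn-S⊆Cn-S̃ : (∀ {x} → x ∈ A → x ∉ S⁻) → Cn S ⊆ₗ Cn S̃
  Cn-S⊆Cn-S̃ A∩S⁻≡∅ p =
    Cn-mono A S̃ (Equivalence.from A⊆S̃⇔A∩S⁻≡∅ A∩S⁻≡∅) (Cn-⊆-Cn-atomScan P S S p)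

  Cn-S≡Cn-S̃ : (∀ {x} → x ∈ A → x ∉ S⁻) → S⁺ ⊆ₗ Cn S →
              (Cn S ⊆ₗ Cn S̃ × Cn S̃ ⊆ₗ Cn S) × FCn P S S̃ ≡ 1ℚ
  Cn-S≡Cn-S̃ A∩S⁻≡∅ S⁺⊆CnS =
    (Cn-S⊆Cn-S̃ A∩S⁻≡∅ , Cn-S̃⊆Cn-S) , FCn-≡1 P S S̃ (Cn-S⊆Cn-S̃ A∩S⁻≡∅) Cn-S̃⊆Cn-S
    where
    Cn-S̃⊆Cn-S : Cn S̃ ⊆ₗ Cn S
    Cn-S̃⊆Cn-S = Cn-least P S̃ S (revision-⊆-Cn P rev S⁺⊆CnS)

  ∉-≡[] : ∀ {xs : List U} {x} → xs ≡ [] → x ∉ xs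
  ∉-≡[] refl = ¬Any[]

  unchanged : S⁻ ≡ [] → S⁺ ≡ [] → ρAtom P S S̃ ≡ 1ℚ × FCn P S S̃ ≡ 1ℚ
  unchanged S⁻≡[] S⁺≡[] =
    Equivalence.from ρ≡1⇔A∩S⁻≡∅ (λ _ → ∉-≡[] S⁻≡[]) ,
    proj₂ (Cn-S≡Cn-S̃ (λ _ → ∉-≡[] S⁻≡[]) (λ x∈S⁺ → contradiction x∈S⁺ (∉-≡[] S⁺≡[])))
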